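{- Let $\phi$ be a formula-term that is disjunctive in the variable $x$. Then $$\mu_x.\phi \;=\; \Big(\bigwedge_{\alpha\in\mathrm{Head}(\phi)}\alpha\Big)\to\Big(\bigvee_{\beta\in\mathrm{Side}(\phi)}\beta\Big),$$ i.e. for every Heyting algebra $H$ and every valuation of the variables other than $x$ in $H$, the interpretation of the right-hand side is the least fixed point of the map $a\mapsto$ (interpretation of $\phi$ with $x\mapsto a$).
   Context: Formula-terms are formulas of intuitionistic propositional logic built from propositional variables, $\top$, $\bot$, $\wedge$, $\vee$, $\to$, interpreted in Heyting algebras in the usual way. The formula-terms disjunctive in $x$ are those generated by the grammar $\phi ::= x \mid \beta \vee \phi \mid \phi \vee \beta \mid \alpha \to \phi \mid \phi \vee \phi$, where $\alpha,\beta$ range over formulas with no occurrence of $x$. In a parse tree of $\phi$ according to this grammar, a formula $\alpha$ occurring as the antecedent in a production $\alpha\to\phi$ is called a head subformula of $\phi$, and a formula $\beta$ occurring in a production $\beta\vee\phi$ or $\phi\vee\beta$ is called a side subformula of $\phi$. $\mathrm{Head}(\phi)$ is the set of head subformulas and $\mathrm{Side}(\phi)$ the set of side subformulas of $\phi$. An empty conjunction is $\top$ and an empty disjunction is $\bot$. $\mu_x.\phi$ denotes the least fixed point of $\phi$ as a function of $x$. -}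

module Defs where

open import Level using (Level)
open import Data.Nat using (ℕ; _≡ᵇ_)
open import Data.Bool using (if_then_else_)
open import Data.List using (List; []; _∷_; _++_; foldr)
open import Relation.Binary.PropositionalEquality using (_≢_)
open import Relation.Binary.Lattice.Bundles using (HeytingAlgebra)

data Fm : Set where
  var  : ℕ → Fm
  ⊤'   : Fm
  ⊥'   : Fm
  _∧'_ : Fm → Fm → Fm
  _∨'_ : Fm → Fm → Fm
  _⇒'_ : Fm → Fm → Fm

data NoOcc (x : ℕ) : Fm → Set where
  var  : ∀ {y} → y ≢ x → NoOcc x (var y)
  top  : NoOcc x ⊤'
  bot  : NoOcc x ⊥'
  and  : ∀ {a b} → NoOcc x a → NoOcc x b → NoOcc x (a ∧' b)
  or   : ∀ {a b} → NoOcc x a → NoOcc x b → NoOcc x (a ∨' b)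
  imp  : ∀ {a b} → NoOcc x a → NoOcc x b → NoOcc x (a ⇒' b)

-- Parse trees witnessing that a formula is disjunctive in x, following the grammar
--   φ ::= x | β ∨ φ | φ ∨ β | α → φ | φ ∨ φ   (α, β x-free)
data Disj (x : ℕ) : Fm → Set where
  hole  : Disj x (var x)
  sideL : ∀ {β φ} → NoOcc x β → Disj x φ → Disj x (β ∨' φ)
  sideR : ∀ {φ β} → Disj x φ → NoOcc x β → Disj x (φ ∨' β)
  head  : ∀ {α φ} → NoOcc x α → Disj x φ → Disj x (α ⇒' φ)
  both  : ∀ {φ ψ} → Disj x φ → Disj x ψ → Disj x (φ ∨' ψ)

Head : ∀ {x φ} → Disj x φ → List Fm
Head hole = []
Head (sideL _ d) = Head d
Head (sideR d _) = Head d
Head (head {α} _ d) = α ∷ Head d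
Head (both d e) = Head d ++ Head e

Side : ∀ {x φ} → Disj x φ → List Fm
Side hole = []
Side (sideL {β} _ d) = β ∷ Side d
Side (sideR {β = β} d _) = β ∷ Side d
Side (head _ d) = Side d
Side (both d e) = Side d ++ Side e

⋀ : List Fm → Fm
⋀ = foldr _∧'_ ⊤'

⋁ : List Fm → Fm
⋁ = foldr _∨'_ ⊥'

module _ {c ℓ₁ ℓ₂ : Level} (H : HeytingAlgebra c ℓ₁ ℓ₂) where
  open HeytingAlgebra H

  ⟦_⟧ : Fm → (ℕ → Carrier) → Carrier
  ⟦ var y ⟧ ρ = ρ y
  ⟦ ⊤' ⟧ ρ = ⊤
  ⟦ ⊥' ⟧ ρ = ⊥
  ⟦ a ∧' b ⟧ ρ = ⟦ a ⟧ ρ ∧ ⟦ b ⟧ ρ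
  ⟦ a ∨' b ⟧ ρ = ⟦ a ⟧ ρ ∨ ⟦ b ⟧ ρ
  ⟦ a ⇒' b ⟧ ρ = ⟦ a ⟧ ρ ⇨ ⟦ b ⟧ ρ

  _[_↦_] : (ℕ → Carrier) → ℕ → Carrier → (ℕ → Carrier)
  (ρ [ x ↦ a ]) y = if y ≡ᵇ x then a else ρ y

  record IsLeastFixedPoint (f : Carrier → Carrier) (r : Carrier) : Set (c Level.⊔ ℓ₁ Level.⊔ ℓ₂) where
    field
      fixed : f r ≈ r
      least : ∀ a → f a ≈ a → r ≤ a

-- Write A and B for the meet of the head and the join of the side subformulas of
-- a parse tree of φ, and φ(a) for φ evaluated with x ↦ a. By induction on the
-- parse tree: φ is inflationary, B ≤ φ(a), φ(a) ≤ A ⇨ (B ∨ a), and every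
-- prefixed point a of φ satisfies A ⇨ a ≤ a. The third bound makes A ⇨ B a
-- prefixed point, hence (by the first) a fixed point; the second and fourth
-- give A ⇨ B ≤ A ⇨ a ≤ a for every fixed point a.
module Submission where

open import Defs
open import Data.Nat using (ℕ; _≡ᵇ_)
open import Data.Nat.Properties using (≡ᵇ⇒≡; ≡⇒≡ᵇ)
open import Data.Bool using (true; false; T)
open import Data.List using ([]; _∷_; _++_)
open import Data.Empty using (⊥-elim)
open import Relation.Binary.PropositionalEquality as ≡ using (_≡_; subst; cong₂)
open import Relation.Binary.Lattice.Bundles using (HeytingAlgebra)
import Relation.Binary.Lattice.Properties.HeytingAlgebra as HeytingAlgebraProperties
import Relation.Binary.Lattice.Properties.MeetSemilattice as MeetSemilatticeProperties
import Relation.Binary.Lattice.Properties.JoinSemilattice as JoinSemilatticeProperties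
import Relation.Binary.Lattice.Properties.BoundedMeetSemilattice as BoundedMeetSemilatticeProperties
import Relation.Binary.Lattice.Properties.BoundedJoinSemilattice as BoundedJoinSemilatticeProperties
import Relation.Binary.Reasoning.PartialOrder as ≤-Reasoning

module _ {c ℓ₁ ℓ₂} (H : HeytingAlgebra c ℓ₁ ℓ₂) where
  open HeytingAlgebra H
  open HeytingAlgebraProperties H
  open MeetSemilatticeProperties meetSemilattice using (∧-assoc; ∧-cong)
  open JoinSemilatticeProperties joinSemilattice using (∨-assoc; ∨-cong; ∨-monotonic)
  open BoundedMeetSemilatticeProperties boundedMeetSemilattice renaming (identityˡ to ∧-identityˡ)
  open BoundedJoinSemilatticeProperties boundedJoinSemilattice renaming (identityˡ to ∨-identityˡ)

  ⊤⇨x≤x : ∀ {x} → ⊤ ⇨ x ≤ x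
  ⊤⇨x≤x = trans (∧-greatest refl (maximum _)) ⇨-eval

  ⇨-absorbs-∨⇨ : ∀ {x y} → x ⇨ (y ∨ (x ⇨ y)) ≤ x ⇨ y
  ⇨-absorbs-∨⇨ = transpose-⇨ (trans (∧-greatest
    (trans ⇨-eval (∨-least y≤x⇨y refl)) (x∧y≤y _ _)) ⇨-eval)

  ≡⇒≤ : ∀ {a b} → a ≡ b → a ≤ b
  ≡⇒≤ ≡.refl = refl

  ⟦_⟧ₕ : Fm → (ℕ → Carrier) → Carrier
  ⟦_⟧ₕ = ⟦_⟧ H

  update-same : ∀ (ρ : ℕ → Carrier) x a → _[_↦_] H ρ x a x ≡ a
  update-same ρ x a with x ≡ᵇ x in eq
  ... | true = ≡.refl
  ... | false = ⊥-elim (subst T eq (≡⇒≡ᵇ x x ≡.refl))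

  ⟦⟧-update-fresh : ∀ (ρ : ℕ → Carrier) {x β} a → NoOcc x β →
                    ⟦ β ⟧ₕ (_[_↦_] H ρ x a) ≡ ⟦ β ⟧ₕ ρ
  ⟦⟧-update-fresh ρ {x} a (var {y} y≢x) with y ≡ᵇ x in eq
  ... | true = ⊥-elim (y≢x (≡ᵇ⇒≡ y x (subst T (≡.sym eq) _)))
  ... | false = ≡.refl
  ⟦⟧-update-fresh ρ a top = ≡.refl
  ⟦⟧-update-fresh ρ a bot = ≡.refl
  ⟦⟧-update-fresh ρ a (and p q) = cong₂ _∧_ (⟦⟧-update-fresh ρ a p) (⟦⟧-update-fresh ρ a q)
  ⟦⟧-update-fresh ρ a (or p q) = cong₂ _∨_ (⟦⟧-update-fresh ρ a p) (⟦⟧-update-fresh ρ a q)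
  ⟦⟧-update-fresh ρ a (imp p q) = cong₂ _⇨_ (⟦⟧-update-fresh ρ a p) (⟦⟧-update-fresh ρ a q)

  ⟦⋀⟧-++ : ∀ ρ xs ys → ⟦ ⋀ (xs ++ ys) ⟧ₕ ρ ≈ ⟦ ⋀ xs ⟧ₕ ρ ∧ ⟦ ⋀ ys ⟧ₕ ρ
  ⟦⋀⟧-++ ρ [] ys = Eq.sym (∧-identityˡ _)
  ⟦⋀⟧-++ ρ (z ∷ xs) ys = Eq.trans (∧-cong Eq.refl (⟦⋀⟧-++ ρ xs ys)) (Eq.sym (∧-assoc _ _ _))

  ⟦⋁⟧-++ : ∀ ρ xs ys → ⟦ ⋁ (xs ++ ys) ⟧ₕ ρ ≈ ⟦ ⋁ xs ⟧ₕ ρ ∨ ⟦ ⋁ ys ⟧ₕ ρ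
  ⟦⋁⟧-++ ρ [] ys = Eq.sym (∨-identityˡ _)
  ⟦⋁⟧-++ ρ (z ∷ xs) ys = Eq.trans (∨-cong Eq.refl (⟦⋁⟧-++ ρ xs ys)) (Eq.sym (∨-assoc _ _ _))

  module _ (x : ℕ) (ρ : ℕ → Carrier) where

    _⟨_⟩ : Fm → Carrier → Carrier
    φ ⟨ a ⟩ = ⟦ φ ⟧ₕ (_[_↦_] H ρ x a)

    heads sides : ∀ {φ} → Disj x φ → Carrier
    heads d = ⟦ ⋀ (Head d) ⟧ₕ ρ
    sides d = ⟦ ⋁ (Side d) ⟧ₕ ρ

    ⟨⟩-inflationary : ∀ {φ} (d : Disj x φ) a → a ≤ φ ⟨ a ⟩
    ⟨⟩-inflationary hole a = ≡⇒≤ (≡.sym (update-same ρ x a))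
    ⟨⟩-inflationary (sideL _ d) a = trans (⟨⟩-inflationary d a) (y≤x∨y _ _)
    ⟨⟩-inflationary (sideR d _) a = trans (⟨⟩-inflationary d a) (x≤x∨y _ _)
    ⟨⟩-inflationary (head _ d) a = trans (⟨⟩-inflationary d a) y≤x⇨y
    ⟨⟩-inflationary (both d _) a = trans (⟨⟩-inflationary d a) (x≤x∨y _ _)

    sides≤⟨⟩ : ∀ {φ} (d : Disj x φ) a → sides d ≤ φ ⟨ a ⟩
    sides≤⟨⟩ hole a = minimum _
    sides≤⟨⟩ (sideL p d) a rewrite ⟦⟧-update-fresh ρ a p = ∨-monotonic refl (sides≤⟨⟩ d a)
    sides≤⟨⟩ (sideR d p) a rewrite ⟦⟧-update-fresh ρ a p =
      ∨-least (y≤x∨y _ _) (trans (sides≤⟨⟩ d a) (x≤x∨y _ _))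
    sides≤⟨⟩ (head _ d) a = trans (sides≤⟨⟩ d a) y≤x⇨y
    sides≤⟨⟩ (both d e) a =
      trans (reflexive (⟦⋁⟧-++ ρ (Side d) (Side e))) (∨-monotonic (sides≤⟨⟩ d a) (sides≤⟨⟩ e a))

    ⟨⟩≤heads⇨sides∨ : ∀ {φ} (d : Disj x φ) a → φ ⟨ a ⟩ ≤ heads d ⇨ (sides d ∨ a)
    ⟨⟩≤heads⇨sides∨ hole a = trans (≡⇒≤ (update-same ρ x a)) (trans (y≤x∨y _ _) y≤x⇨y)
    ⟨⟩≤heads⇨sides∨ (sideL p d) a rewrite ⟦⟧-update-fresh ρ a p = ∨-least
      (trans (x≤x∨y _ _) (trans (x≤x∨y _ _) y≤x⇨y))
      (trans (⟨⟩≤heads⇨sides∨ d a) (⇨ʳ-covariant (∨-monotonic (y≤x∨y _ _) refl)))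
    ⟨⟩≤heads⇨sides∨ (sideR d p) a rewrite ⟦⟧-update-fresh ρ a p = ∨-least
      (trans (⟨⟩≤heads⇨sides∨ d a) (⇨ʳ-covariant (∨-monotonic (y≤x∨y _ _) refl)))
      (trans (x≤x∨y _ _) (trans (x≤x∨y _ _) y≤x⇨y))
    ⟨⟩≤heads⇨sides∨ (head p d) a rewrite ⟦⟧-update-fresh ρ a p =
      trans (⇨ʳ-covariant (⟨⟩≤heads⇨sides∨ d a)) (reflexive (Eq.sym ⇨-curry))
    ⟨⟩≤heads⇨sides∨ (both d e) a = ∨-least
      (trans (⟨⟩≤heads⇨sides∨ d a) (⇨-relax heads≤ˡ (∨-monotonic sides≥ˡ refl)))
      (trans (⟨⟩≤heads⇨sides∨ e a) (⇨-relax heads≤ʳ (∨-monotonic sides≥ʳ refl)))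
      where
      heads≤ˡ : heads (both d e) ≤ heads d
      heads≤ˡ = trans (reflexive (⟦⋀⟧-++ ρ (Head d) (Head e))) (x∧y≤x _ _)
      heads≤ʳ : heads (both d e) ≤ heads e
      heads≤ʳ = trans (reflexive (⟦⋀⟧-++ ρ (Head d) (Head e))) (x∧y≤y _ _)
      sides≥ˡ : sides d ≤ sides (both d e)
      sides≥ˡ = trans (x≤x∨y _ _) (reflexive (Eq.sym (⟦⋁⟧-++ ρ (Side d) (Side e))))
      sides≥ʳ : sides e ≤ sides (both d e)
      sides≥ʳ = trans (y≤x∨y _ _) (reflexive (Eq.sym (⟦⋁⟧-++ ρ (Side d) (Side e))))

    prefixed⇒heads⇨≤ : ∀ {φ} (d : Disj x φ) a → φ ⟨ a ⟩ ≤ a → heads d ⇨ a ≤ a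
    prefixed⇒heads⇨≤ hole a _ = ⊤⇨x≤x
    prefixed⇒heads⇨≤ (sideL _ d) a φa≤a = prefixed⇒heads⇨≤ d a (trans (y≤x∨y _ _) φa≤a)
    prefixed⇒heads⇨≤ (sideR d _) a φa≤a = prefixed⇒heads⇨≤ d a (trans (x≤x∨y _ _) φa≤a)
    prefixed⇒heads⇨≤ (head {α} {φ} p d) a φa≤a rewrite ⟦⟧-update-fresh ρ a p = begin
      (⟦ α ⟧ₕ ρ ∧ heads d) ⇨ a  ≈⟨ ⇨-curry ⟩
      ⟦ α ⟧ₕ ρ ⇨ (heads d ⇨ a)  ≤⟨ ⇨ʳ-covariant (prefixed⇒heads⇨≤ d a (trans y≤x⇨y φa≤a)) ⟩
      ⟦ α ⟧ₕ ρ ⇨ a              ≤⟨ ⇨ʳ-covariant (⟨⟩-inflationary d a) ⟩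
      ⟦ α ⟧ₕ ρ ⇨ φ ⟨ a ⟩        ≤⟨ φa≤a ⟩
      a                         ∎
      where open ≤-Reasoning poset
    prefixed⇒heads⇨≤ (both d e) a φa≤a = begin
      heads (both d e) ⇨ a      ≈⟨ ⇨-cong (⟦⋀⟧-++ ρ (Head d) (Head e)) Eq.refl ⟩
      (heads d ∧ heads e) ⇨ a   ≈⟨ ⇨-curry ⟩
      heads d ⇨ (heads e ⇨ a)   ≤⟨ ⇨ʳ-covariant (prefixed⇒heads⇨≤ e a (trans (y≤x∨y _ _) φa≤a)) ⟩
      heads d ⇨ a               ≤⟨ prefixed⇒heads⇨≤ d a (trans (x≤x∨y _ _) φa≤a) ⟩
      a                         ∎
      where open ≤-Reasoning poset

    heads⇨sides-isLeastFixedPoint : ∀ {φ} (d : Disj x φ) →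
                                    IsLeastFixedPoint H (φ ⟨_⟩) (heads d ⇨ sides d)
    heads⇨sides-isLeastFixedPoint d = record
      { fixed = antisym (trans (⟨⟩≤heads⇨sides∨ d r) ⇨-absorbs-∨⇨) (⟨⟩-inflationary d r)
      ; least = λ a φa≈a → trans (⇨ʳ-covariant (trans (sides≤⟨⟩ d a) (reflexive φa≈a)))
                                 (prefixed⇒heads⇨≤ d a (reflexive φa≈a))
      }
      where
      r : Carrier
      r = heads d ⇨ sides d

mainTheorem4 : ∀ {c ℓ₁ ℓ₂} (x : ℕ) (φ : Fm) (d : Disj x φ)
    (H : HeytingAlgebra c ℓ₁ ℓ₂) (ρ : ℕ → HeytingAlgebra.Carrier H) →
    IsLeastFixedPoint H (λ a → ⟦_⟧ H φ (_[_↦_] H ρ x a)) (⟦_⟧ H (⋀ (Head d) ⇒' ⋁ (Side d)) ρ)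
mainTheorem4 x φ d H ρ = heads⇨sides-isLeastFixedPoint H x ρ d
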